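{- Let $h\ge2$ be an integer and let $T$ be a finite rooted tree with $n$ leaves in which every vertex has at most $h$ children. Then $T$ contains a binary subtree with at least $n^{1/\log_2 h}$ leaves; that is, there is a set $L$ of leaves of $T$ with $|L|\ge n^{1/\log_2 h}$ such that the subtree of $T$ formed by the union of the paths from the root to the leaves in $L$ has every vertex with at most two children. -}

module Defs where

open import Data.Nat using (ℕ; zero; suc; _+_; _*_; _^_; _≤_; _<_)
open import Data.List using (List; []; _∷_; length; lookup)
open import Data.Fin using (Fin)
open import Data.Empty using (⊥)
open import Relation.Binary.PropositionalEquality using (_≡_; _≢_)
open import Data.Product using (Σ; _×_)
open import Data.List.Membership.Propositional using (_∈_)

data Tree : Set where
  node : List Tree → Tree

children : Tree → List Tree
children (node ts) = ts

deg : Tree → ℕ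
deg t = length (children t)

-- Positions (= vertices) of a tree, given by the path from the root.
data Pos : Tree → Set where
  here  : ∀ {t} → Pos t
  there : ∀ {ts} (i : Fin (length ts)) → Pos (lookup ts i) → Pos (node ts)

subtreeAt : (t : Tree) → Pos t → Tree
subtreeAt t here = t
subtreeAt (node ts) (there i p) = subtreeAt (lookup ts i) p

IsLeaf : (t : Tree) → Pos t → Set
IsLeaf t p = children (subtreeAt t p) ≡ []

childOf : (t : Tree) (p : Pos t) → Fin (deg (subtreeAt t p)) → Pos t
childOf (node ts) here i = there i here
childOf (node ts) (there j p) i = there j (childOf (lookup ts j) p i)

data _≼_ : ∀ {t} → Pos t → Pos t → Set where
  here≼  : ∀ {t} {q : Pos t} → here ≼ q
  there≼ : ∀ {ts} {i : Fin (length ts)} {p q : Pos (lookup ts i)} →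
           _≼_ {lookup ts i} p q → _≼_ {node ts} (there i p) (there i q)

mutual
  leafCount : Tree → ℕ
  leafCount (node []) = 1
  leafCount (node (t ∷ ts)) = leafCount t + leafCountList ts

  leafCountList : List Tree → ℕ
  leafCountList [] = 0
  leafCountList (t ∷ ts) = leafCount t + leafCountList ts

MaxChildren : ℕ → Tree → Set
MaxChildren h t = (p : Pos t) → deg (subtreeAt t p) ≤ h

-- The vertex p has child i in the subtree formed by the union of the
-- root-to-leaf paths to the leaves in L: some ℓ ∈ L passes through child i of p.
UsedChild : (t : Tree) → List (Pos t) → (p : Pos t) → Fin (deg (subtreeAt t p)) → Set
UsedChild t L p i = Σ (Pos t) (λ ℓ → (ℓ ∈ L) × (childOf t p i ≼ ℓ))

-- the subtree spanned by L is binary: no vertex of it has three distinct children in it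
-- (vertices outside the spanned subtree have no used children, so quantifying over all
--  vertices of t is the same as quantifying over vertices of the spanned subtree)
SpansBinary : (t : Tree) → List (Pos t) → Set
SpansBinary t L = (p : Pos t) (i j k : Fin (deg (subtreeAt t p))) →
  i ≢ j → j ≢ k → i ≢ k →
  UsedChild t L p i → UsedChild t L p j → UsedChild t L p k → ⊥

-- RootPowBound h n m  encodes the real inequality  m ≥ n ^ (1 / log₂ h),
-- i.e.  log₂ m · log₂ h ≥ log₂ n  (for m, n ≥ 1, h ≥ 2), without real numbers:
-- for all rationals a = p/q > log₂ m  (⇔ m^q < 2^p)  and
--             b = r/s > log₂ h  (⇔ h^s < 2^r)  we have  a·b ≥ log₂ n  (⇔ n^(q s) ≤ 2^(p r)).
RootPowBound : ℕ → ℕ → ℕ → Set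
RootPowBound h n m = (p q r s : ℕ) → 1 ≤ q → 1 ≤ s →
  m ^ q < 2 ^ p → h ^ s < 2 ^ r → n ^ (q * s) ≤ 2 ^ (p * r)

-- Let F 0 = 0, F 1 = 1 and F n = F ⌈n/2⌉ + (h − 1) F ⌊n/2⌋ for n ≥ 2 (leafBound below).
-- By induction on the tree, T has a binary leaf set L with leafCount T ≤ F |L|: at a node,
-- keep the selections of the two children whose selections are largest, of sizes a ≥ b;
-- each of the at most h − 1 other children has at most F b leaves, and
-- F a + (h − 1) F b ≤ F (a + b), proved by halving a and b.  Moreover F is
-- supermultiplicative and F (2 ^ p) = h ^ p, so F m is at most m ^ (log₂ h):
-- m ^ q < 2 ^ p gives F m ^ q ≤ F (m ^ q) ≤ F (2 ^ p) = h ^ p.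
module Submission where

open import Defs
open import Data.Nat hiding (parity; _≟_)
open import Data.Nat.Properties hiding (_≟_)
open import Data.Nat.Induction using (<-rec)
open import Data.Nat.Tactic.RingSolver using (solve-∀)
open import Data.Fin using (Fin; zero; suc; punchIn; _≟_)
open import Data.Fin.Properties using (punchInᵢ≢i)
open import Data.Vec.Functional using (Vector; removeAt)
open import Data.List using (List; []; _∷_; length; lookup; map; _++_; allFin)
open import Data.List.Properties using (length-map; length-++)
open import Data.List.Extrema.Nat using (argmax; f[xs]≤f[argmax])
open import Data.List.Membership.Propositional using (_∈_)
open import Data.List.Membership.Propositional.Properties using (∈-map⁻; ∈-++⁻; ∈-allFin)
open import Data.List.Relation.Unary.All using (All; []; _∷_)
import Data.List.Relation.Unary.All as All
import Data.List.Relation.Unary.All.Properties as All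
open import Data.List.Relation.Unary.Unique.Propositional using (Unique; []; _∷_)
import Data.List.Relation.Unary.Unique.Propositional.Properties as Unique
open import Data.Product using (Σ; ∃; _×_; _,_; proj₁; proj₂)
open import Data.Sum using (_⊎_; inj₁; inj₂)
open import Data.Empty using (⊥; ⊥-elim)
open import Function using (_∘_; _∘′_)
open import Relation.Nullary using (¬_; yes; no)
open import Relation.Binary.PropositionalEquality
open import Algebra.Properties.CommutativeSemigroup +-commutativeSemigroup using () renaming (interchange to +-interchange)
open import Algebra.Properties.CommutativeMonoid.Sum +-0-commutativeMonoid using (sum; sum-remove)

data Parity : ℕ → Set where
  even : ∀ k → Parity (k + k)
  odd  : ∀ k → Parity (suc (k + k))

parity : ∀ n → Parity n
parity zero = even zero
parity (suc n) with parity n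
... | even k = odd k
... | odd k  = subst (Parity ∘′ suc) (+-suc k k) (even (suc k))

interchange-scaled : ∀ g a b c d → (a + g * b) + g * (c + g * d) ≡ (a + g * c) + g * (b + g * d)
interchange-scaled = solve-∀

-- c = d + e: the left side exceeds a + g * b + g * d + g * (g * d) by g * e, the right side by g * (g * e).
interchange-scaled-≤ : ∀ g a b c d → d ≤ c → (a + g * b) + g * (c + g * d) ≤ (a + g * d) + g * (b + g * c)
interchange-scaled-≤ g a b c d d≤c with m≤n⇒∃[o]m+o≡n d≤c
... | e , refl = begin
  (a + g * b) + g * ((d + e) + g * d) ≡⟨ split-left g a b d e ⟩
  base + g * e                        ≤⟨ +-monoʳ-≤ base (≤-square g e) ⟩
  base + g * (g * e)                  ≡⟨ split-right g a b d e ⟨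
  (a + g * d) + g * (b + g * (d + e)) ∎
  where
  open ≤-Reasoning
  base = a + g * b + g * d + g * (g * d)
  split-left : ∀ g a b d e → (a + g * b) + g * ((d + e) + g * d) ≡ (a + g * b + g * d + g * (g * d)) + g * e
  split-left = solve-∀
  split-right : ∀ g a b d e → (a + g * d) + g * (b + g * (d + e)) ≡ (a + g * b + g * d + g * (g * d)) + g * (g * e)
  split-right = solve-∀
  ≤-square : ∀ g e → g * e ≤ g * (g * e)
  ≤-square zero e = z≤n
  ≤-square g@(suc _) e = *-monoʳ-≤ g (m≤n*m e g)

⌊even/2⌋ : ∀ k → ⌊ k + k /2⌋ ≡ k
⌊even/2⌋ k = sym (n≡⌊n+n/2⌋ k)

⌈even/2⌉ : ∀ k → ⌈ k + k /2⌉ ≡ k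
⌈even/2⌉ k = sym (n≡⌈n+n/2⌉ k)

⌊odd/2⌋ : ∀ k → ⌊ suc (k + k) /2⌋ ≡ k
⌊odd/2⌋ = ⌈even/2⌉

⌈odd/2⌉ : ∀ k → ⌈ suc (k + k) /2⌉ ≡ suc k
⌈odd/2⌉ k = cong suc (⌊even/2⌋ k)

even+even : ∀ a b → (a + a) + (b + b) ≡ (a + b) + (a + b)
even+even a b = +-interchange a a b b

odd+even : ∀ a b → suc (a + a) + (b + b) ≡ suc ((a + b) + (a + b))
odd+even a b = cong suc (even+even a b)

even+odd : ∀ a b → (a + a) + suc (b + b) ≡ suc ((a + b) + (a + b))
even+odd a b = trans (+-suc (a + a) (b + b)) (odd+even a b)

odd+odd : ∀ a b → suc (a + a) + suc (b + b) ≡ suc (a + b) + suc (a + b)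
odd+odd = solve-∀

<-pred-≤ : ∀ {a n k} → a < n → n ≤ suc k → a ≤ k
<-pred-≤ a<n n≤1+k = s≤s⁻¹ (<-≤-trans a<n n≤1+k)

pair-halves : ∀ g {X Y Z p₁ p₂ q₁ q₂ r₁ r₂} →
  X ≡ p₁ + g * p₂ → Y ≡ q₁ + g * q₂ →
  p₁ + g * q₁ ≤ r₁ → p₂ + g * q₂ ≤ r₂ → Z ≡ r₁ + g * r₂ → X + g * Y ≤ Z
pair-halves g {p₁ = p₁} {p₂} {q₁} {q₂} {r₁} {r₂} refl refl ≤r₁ ≤r₂ refl = begin
  (p₁ + g * p₂) + g * (q₁ + g * q₂) ≡⟨ interchange-scaled g _ _ _ _ ⟩
  (p₁ + g * q₁) + g * (p₂ + g * q₂) ≤⟨ +-mono-≤ ≤r₁ (*-monoʳ-≤ g ≤r₂) ⟩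
  r₁ + g * r₂                       ∎
  where open ≤-Reasoning

pair-halves-crosswise : ∀ g {X Y Z p₁ p₂ q₁ q₂ r₁ r₂} → q₂ ≤ q₁ →
  X ≡ p₁ + g * p₂ → Y ≡ q₁ + g * q₂ →
  p₁ + g * q₂ ≤ r₁ → p₂ + g * q₁ ≤ r₂ → Z ≡ r₁ + g * r₂ → X + g * Y ≤ Z
pair-halves-crosswise g {p₁ = p₁} {p₂} {q₁} {q₂} {r₁} {r₂} q₂≤q₁ refl refl ≤r₁ ≤r₂ refl = begin
  (p₁ + g * p₂) + g * (q₁ + g * q₂) ≤⟨ interchange-scaled-≤ g _ _ _ _ q₂≤q₁ ⟩
  (p₁ + g * q₂) + g * (p₂ + g * q₁) ≤⟨ +-mono-≤ ≤r₁ (*-monoʳ-≤ g ≤r₂) ⟩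
  r₁ + g * r₂                       ∎
  where open ≤-Reasoning

sum-mono-≤ : ∀ {n} {f g : Vector ℕ n} → (∀ i → f i ≤ g i) → sum f ≤ sum g
sum-mono-≤ {zero}  _   = z≤n
sum-mono-≤ {suc n} f≤g = +-mono-≤ (f≤g zero) (sum-mono-≤ (f≤g ∘ suc))

sum-≤-* : ∀ {n} {f : Vector ℕ n} {b} → (∀ i → f i ≤ b) → sum f ≤ n * b
sum-≤-* {zero}  _   = z≤n
sum-≤-* {suc n} f≤b = +-mono-≤ (f≤b zero) (sum-≤-* (f≤b ∘ suc))

argmax-Fin : ∀ {k} (v : Vector ℕ (suc k)) → ∃ λ i → ∀ j → v j ≤ v i
argmax-Fin v =
  argmax v zero (allFin _) , λ j → All.lookup (f[xs]≤f[argmax] {f = v} zero (allFin _)) (∈-allFin j)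

record TwoLargest {k} (v : Vector ℕ (suc (suc k))) : Set where
  field
    first second  : Fin (suc (suc k))
    first≢second  : first ≢ second
    second≤first  : v second ≤ v first
    others≤second : ∀ j → v (punchIn first j) ≤ v second

twoLargest : ∀ {k} (v : Vector ℕ (suc (suc k))) → TwoLargest v
twoLargest v = record
  { first = i ; second = punchIn i j ; first≢second = punchInᵢ≢i i j ∘ sym
  ; second≤first = v≤vi (punchIn i j) ; others≤second = rest≤vj }
  where
  i = proj₁ (argmax-Fin v)
  v≤vi = proj₂ (argmax-Fin v)
  j = proj₁ (argmax-Fin (removeAt v i))
  rest≤vj = proj₂ (argmax-Fin (removeAt v i))

module LeafBound (g : ℕ) where

  -- leafBound′ k n ≡ leafBound n once n ≤ k; the fuel k makes the halving recursion structural.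
  leafBound′ : ℕ → ℕ → ℕ
  leafBound′ zero    _ = 0
  leafBound′ (suc k) 0 = 0
  leafBound′ (suc k) 1 = 1
  leafBound′ (suc k) n@(suc (suc _)) = leafBound′ k ⌈ n /2⌉ + g * leafBound′ k ⌊ n /2⌋

  leafBound : ℕ → ℕ
  leafBound n = leafBound′ n n

  leafBound′-fuel : ∀ {k k′ n} → n ≤ k → n ≤ k′ → leafBound′ k n ≡ leafBound′ k′ n
  leafBound′-fuel {zero}  {zero}  z≤n z≤n = refl
  leafBound′-fuel {zero}  {suc _} z≤n z≤n = refl
  leafBound′-fuel {suc _} {zero}  z≤n z≤n = refl
  leafBound′-fuel {suc _} {suc _} {zero}     _ _ = refl
  leafBound′-fuel {suc _} {suc _} {suc zero} _ _ = refl
  leafBound′-fuel {suc _} {suc _} {suc (suc m)} n≤k n≤k′ =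
    cong₂ (λ a b → a + g * b)
      (leafBound′-fuel (<-pred-≤ (⌈n/2⌉<n m) n≤k) (<-pred-≤ (⌈n/2⌉<n m) n≤k′))
      (leafBound′-fuel (<-pred-≤ (⌊n/2⌋<n (suc m)) n≤k) (<-pred-≤ (⌊n/2⌋<n (suc m)) n≤k′))

  leafBound-halves : ∀ n → leafBound n ≡ leafBound ⌈ n /2⌉ + g * leafBound ⌊ n /2⌋
  leafBound-halves zero = sym (*-zeroʳ g)
  leafBound-halves (suc zero) = cong suc (sym (*-zeroʳ g))
  leafBound-halves n@(suc (suc m)) =
    cong₂ (λ a b → a + g * b)
      (leafBound′-fuel (<-pred-≤ (⌈n/2⌉<n m) ≤-refl) ≤-refl)
      (leafBound′-fuel (<-pred-≤ (⌊n/2⌋<n (suc m)) ≤-refl) ≤-refl)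

  leafBound-double : ∀ k → leafBound (k + k) ≡ suc g * leafBound k
  leafBound-double k =
    trans (leafBound-halves (k + k)) (cong₂ (λ a b → leafBound a + g * leafBound b) (⌈even/2⌉ k) (⌊even/2⌋ k))

  leafBound-odd : ∀ k → leafBound (suc (k + k)) ≡ leafBound (suc k) + g * leafBound k
  leafBound-odd k =
    trans (leafBound-halves (suc (k + k))) (cong₂ (λ a b → leafBound a + g * leafBound b) (⌈odd/2⌉ k) (⌊odd/2⌋ k))

  leafBound-mono : ∀ {m n} → m ≤ n → leafBound m ≤ leafBound n
  leafBound-mono {n = n} = <-rec (λ n → ∀ {m} → m ≤ n → leafBound m ≤ leafBound n) step n
    where
    step : ∀ n → (∀ {k} → k < n → ∀ {m} → m ≤ k → leafBound m ≤ leafBound k) →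
           ∀ {m} → m ≤ n → leafBound m ≤ leafBound n
    step _ _ z≤n = z≤n
    step (suc zero) _ (s≤s z≤n) = ≤-refl
    step n@(suc (suc k)) ih {m} m≤n = begin
      leafBound m
        ≡⟨ leafBound-halves m ⟩
      leafBound ⌈ m /2⌉ + g * leafBound ⌊ m /2⌋
        ≤⟨ +-mono-≤ (ih (⌈n/2⌉<n k) (⌈n/2⌉-mono m≤n)) (*-monoʳ-≤ g (ih (⌊n/2⌋<n (suc k)) (⌊n/2⌋-mono m≤n))) ⟩
      leafBound ⌈ n /2⌉ + g * leafBound ⌊ n /2⌋
        ≡⟨ leafBound-halves n ⟨
      leafBound n
        ∎
      where open ≤-Reasoning

  Superadditive : ℕ → Set
  Superadditive x = ∀ {y} → y ≤ x → leafBound x + g * leafBound y ≤ leafBound (x + y)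

  superadditive-suc : ∀ {a b} → Superadditive a → suc b ≤ a →
    leafBound a + g * leafBound (suc b) ≤ leafBound (suc (a + b))
  superadditive-suc {a} {b} superadditive b<a =
    subst (λ n → leafBound a + g * leafBound (suc b) ≤ leafBound n) (+-suc a b) (superadditive b<a)

  leafBound-superadditive : ∀ {x y} → y ≤ x → leafBound x + g * leafBound y ≤ leafBound (x + y)
  leafBound-superadditive {x} = <-rec Superadditive step x
    where
    step : ∀ x → (∀ {a} → a < x → Superadditive a) → Superadditive x
    step x ih {y} y≤x with parity x | parity y
    ... | _ | even zero = ≤-reflexive (begin
      leafBound x + g * 0 ≡⟨ cong (leafBound x +_) (*-zeroʳ g) ⟩
      leafBound x + 0     ≡⟨ +-identityʳ _ ⟩
      leafBound x         ≡⟨ cong leafBound (+-identityʳ x) ⟨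
      leafBound (x + 0)   ∎)
      where open ≡-Reasoning
    ... | even A | even B@(suc _) =
      pair-halves g (leafBound-double A) (leafBound-double B) (ih A<x B≤A) (ih A<x B≤A)
        (trans (cong leafBound (even+even A B)) (leafBound-double (A + B)))
      where
      B≤A = subst₂ _≤_ (⌊even/2⌋ B) (⌊even/2⌋ A) (⌊n/2⌋-mono y≤x)
      A<x = m<m+n A (<-≤-trans z<s B≤A)
    ... | odd A | even B@(suc _) =
      pair-halves g (leafBound-odd A) (leafBound-double B) (ih A+1<x (m≤n⇒m≤1+n B≤A)) (ih A<x B≤A)
        (trans (cong leafBound (odd+even A B)) (leafBound-odd (A + B)))
      where
      B≤A = subst₂ _≤_ (⌊even/2⌋ B) (⌊odd/2⌋ A) (⌊n/2⌋-mono y≤x)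
      A+1<x = s<s (m<m+n A (<-≤-trans z<s B≤A))
      A<x = s≤s (m≤m+n A A)
    ... | even A | odd B =
      pair-halves g (leafBound-double A) (leafBound-odd B) (superadditive-suc (ih A<x) B<A) (ih A<x (<⇒≤ B<A))
        (trans (cong leafBound (even+odd A B)) (leafBound-odd (A + B)))
      where
      B<A = subst₂ _≤_ (⌈odd/2⌉ B) (⌈even/2⌉ A) (⌈n/2⌉-mono y≤x)
      A<x = m<m+n A (<-≤-trans z<s B<A)
    ... | odd A | odd B with m≤n⇒m<n∨m≡n (subst₂ _≤_ (⌊odd/2⌋ B) (⌊odd/2⌋ A) (⌊n/2⌋-mono y≤x))
    ...   | inj₂ refl = ≤-reflexive (sym (leafBound-double x))
    -- Upper halves together would exceed the upper half of x + y by one, so pair them crosswise.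
    ...   | inj₁ B<A =
      pair-halves-crosswise g (leafBound-mono (n≤1+n B)) (leafBound-odd A) (leafBound-odd B)
        (ih A+1<x (m≤n⇒m≤1+n (<⇒≤ B<A))) (superadditive-suc (ih A<x) B<A)
        (trans (cong leafBound (odd+odd A B)) (leafBound-double (suc (A + B))))
      where
      A+1<x = s<s (m<m+n A (≤-<-trans z≤n B<A))
      A<x = s≤s (m≤m+n A A)

  leafBound-supermultiplicative : ∀ a b → leafBound a * leafBound b ≤ leafBound (a * b)
  leafBound-supermultiplicative = <-rec (λ a → ∀ b → leafBound a * leafBound b ≤ leafBound (a * b)) step
    where
    step : ∀ a → (∀ {c} → c < a → ∀ b → leafBound c * leafBound b ≤ leafBound (c * b)) →
           ∀ b → leafBound a * leafBound b ≤ leafBound (a * b)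
    step zero _ b = z≤n
    step (suc zero) _ b = ≤-reflexive (trans (+-identityʳ _) (cong leafBound (sym (+-identityʳ b))))
    step a@(suc (suc k)) ih b = begin
      leafBound a * leafBound b
        ≡⟨ cong (_* leafBound b) (leafBound-halves a) ⟩
      (leafBound ⌈a/2⌉ + g * leafBound ⌊a/2⌋) * leafBound b
        ≡⟨ distribute (leafBound ⌈a/2⌉) (leafBound ⌊a/2⌋) (leafBound b) ⟩
      leafBound ⌈a/2⌉ * leafBound b + g * (leafBound ⌊a/2⌋ * leafBound b)
        ≤⟨ +-mono-≤ (ih (⌈n/2⌉<n k) b) (*-monoʳ-≤ g (ih (⌊n/2⌋<n (suc k)) b)) ⟩
      leafBound (⌈a/2⌉ * b) + g * leafBound (⌊a/2⌋ * b)
        ≤⟨ leafBound-superadditive (*-monoˡ-≤ b (⌊n/2⌋≤⌈n/2⌉ a)) ⟩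
      leafBound (⌈a/2⌉ * b + ⌊a/2⌋ * b)
        ≡⟨ cong leafBound (*-distribʳ-+ b ⌈a/2⌉ ⌊a/2⌋) ⟨
      leafBound ((⌈a/2⌉ + ⌊a/2⌋) * b)
        ≡⟨ cong (λ n → leafBound (n * b)) (trans (+-comm ⌈a/2⌉ ⌊a/2⌋) (⌊n/2⌋+⌈n/2⌉≡n a)) ⟩
      leafBound (a * b)
        ∎
      where
      open ≤-Reasoning
      ⌈a/2⌉ = ⌈ a /2⌉
      ⌊a/2⌋ = ⌊ a /2⌋
      distribute : ∀ x y z → (x + g * y) * z ≡ x * z + g * (y * z)
      distribute x y z = trans (*-distribʳ-+ z x (g * y)) (cong (x * z +_) (*-assoc g y z))

  leafBound-^ : ∀ m q → leafBound m ^ q ≤ leafBound (m ^ q)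
  leafBound-^ m zero = ≤-refl
  leafBound-^ m (suc q) =
    ≤-trans (*-monoʳ-≤ (leafBound m) (leafBound-^ m q)) (leafBound-supermultiplicative m (m ^ q))

  leafBound-2^ : ∀ p → leafBound (2 ^ p) ≡ suc g ^ p
  leafBound-2^ zero = refl
  leafBound-2^ (suc p) = begin
    leafBound (2 ^ p + (2 ^ p + 0)) ≡⟨ cong (λ n → leafBound (2 ^ p + n)) (+-identityʳ (2 ^ p)) ⟩
    leafBound (2 ^ p + 2 ^ p)       ≡⟨ leafBound-double (2 ^ p) ⟩
    suc g * leafBound (2 ^ p)       ≡⟨ cong (suc g *_) (leafBound-2^ p) ⟩
    suc g * suc g ^ p               ∎
    where open ≡-Reasoning

  leafBound-root : ∀ {n m} p q → n ≤ leafBound m → m ^ q < 2 ^ p → n ^ q ≤ suc g ^ p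
  leafBound-root {n} {m} p q n≤ m^q<2^p = begin
    n ^ q               ≤⟨ ^-monoˡ-≤ q n≤ ⟩
    leafBound m ^ q     ≤⟨ leafBound-^ m q ⟩
    leafBound (m ^ q)   ≤⟨ leafBound-mono (<⇒≤ m^q<2^p) ⟩
    leafBound (2 ^ p)   ≡⟨ leafBound-2^ p ⟩
    suc g ^ p           ∎
    where open ≤-Reasoning

  leafBound-sum-≤ : ∀ {k} (v : Vector ℕ (suc (suc k))) (top : TwoLargest v) → suc k ≤ g →
    sum (leafBound ∘ v) ≤ leafBound (v (TwoLargest.first top) + v (TwoLargest.second top))
  leafBound-sum-≤ {k} v top k<g = begin
    sum (leafBound ∘ v)
      ≡⟨ sum-remove {i = i₁} (leafBound ∘ v) ⟩
    leafBound (v i₁) + sum (removeAt (leafBound ∘ v) i₁)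
      ≤⟨ +-monoʳ-≤ (leafBound (v i₁)) (sum-≤-* (λ j → leafBound-mono (others≤second j))) ⟩
    leafBound (v i₁) + suc k * leafBound (v i₂)
      ≤⟨ +-monoʳ-≤ (leafBound (v i₁)) (*-monoˡ-≤ (leafBound (v i₂)) k<g) ⟩
    leafBound (v i₁) + g * leafBound (v i₂)
      ≤⟨ leafBound-superadditive second≤first ⟩
    leafBound (v i₁ + v i₂)
      ∎
    where
    open ≤-Reasoning
    open TwoLargest top renaming (first to i₁; second to i₂)

rootPowBound : ∀ {h n m} → (∀ p q → m ^ q < 2 ^ p → n ^ q ≤ h ^ p) → RootPowBound h n m
rootPowBound {h} {n} {m} dominated p q r s _ _ m^q<2^p h^s<2^r = begin
  n ^ (q * s) ≡⟨ ^-*-assoc n q s ⟨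
  (n ^ q) ^ s ≤⟨ ^-monoˡ-≤ s (dominated p q m^q<2^p) ⟩
  (h ^ p) ^ s ≡⟨ ^-*-assoc h p s ⟩
  h ^ (p * s) ≡⟨ cong (h ^_) (*-comm p s) ⟩
  h ^ (s * p) ≡⟨ ^-*-assoc h s p ⟨
  (h ^ s) ^ p ≤⟨ ^-monoˡ-≤ p (<⇒≤ h^s<2^r) ⟩
  (2 ^ r) ^ p ≡⟨ ^-*-assoc 2 r p ⟩
  2 ^ (r * p) ≡⟨ cong (2 ^_) (*-comm r p) ⟩
  2 ^ (p * r) ∎
  where open ≤-Reasoning

BinaryLeafSet : (t : Tree) → List (Pos t) → Set
BinaryLeafSet t L = All (IsLeaf t) L × Unique L × SpansBinary t L

NoThreeUsed : (t : Tree) → List (Pos t) → Pos t → Set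
NoThreeUsed t L p = (i j k : Fin (deg (subtreeAt t p))) → i ≢ j → j ≢ k → i ≢ k →
  UsedChild t L p i → UsedChild t L p j → UsedChild t L p k → ⊥

noThreeUsed-pair : ∀ {t L} p {i j : Fin (deg (subtreeAt t p))} →
  (∀ {c} → UsedChild t L p c → c ≡ i ⊎ c ≡ j) → NoThreeUsed t L p
noThreeUsed-pair _ {i} {j} used a b c a≢b b≢c a≢c ua ub uc = go (used ua) (used ub) (used uc)
  where
  go : a ≡ i ⊎ a ≡ j → b ≡ i ⊎ b ≡ j → c ≡ i ⊎ c ≡ j → ⊥
  go (inj₁ refl) (inj₁ refl) _           = a≢b refl
  go (inj₂ refl) (inj₂ refl) _           = a≢b refl
  go (inj₁ refl) (inj₂ refl) (inj₁ refl) = a≢c refl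
  go (inj₁ refl) (inj₂ refl) (inj₂ refl) = b≢c refl
  go (inj₂ refl) (inj₁ refl) (inj₁ refl) = b≢c refl
  go (inj₂ refl) (inj₁ refl) (inj₂ refl) = a≢c refl

noThreeUsed-unused : ∀ {t L} p → (∀ {c} → ¬ UsedChild t L p c) → NoThreeUsed t L p
noThreeUsed-unused _ unused _ _ _ _ _ _ ua _ _ = unused ua

used-++ : ∀ {t} X {Y : List (Pos t)} p {C : Fin (deg (subtreeAt t p)) → Set} →
  (∀ {c} → UsedChild t X p c → C c) → (∀ {c} → UsedChild t Y p c → C c) →
  ∀ {c} → UsedChild t (X ++ Y) p c → C c
used-++ X _ usedX usedY (ℓ , ℓ∈ , c≼ℓ) with ∈-++⁻ X ℓ∈
... | inj₁ ℓ∈X = usedX (ℓ , ℓ∈X , c≼ℓ)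
... | inj₂ ℓ∈Y = usedY (ℓ , ℓ∈Y , c≼ℓ)

leaf-binaryLeafSet : BinaryLeafSet (node []) (here ∷ [])
leaf-binaryLeafSet = refl ∷ [] , [] ∷ [] , spans
  where
  spans : SpansBinary (node []) (here ∷ [])
  spans here ()
  spans (there () _)

module _ {ts : List Tree} where

  noThreeUsed-there : ∀ {i L A} p →
    (∀ {c} → UsedChild (node ts) L (there i p) c → UsedChild (lookup ts i) A p c) →
    NoThreeUsed (lookup ts i) A p → NoThreeUsed (node ts) L (there i p)
  noThreeUsed-there _ down noThree a b c a≢b b≢c a≢c ua ub uc =
    noThree a b c a≢b b≢c a≢c (down ua) (down ub) (down uc)

  there-injective : ∀ {i} {x y : Pos (lookup ts i)} → there {ts} i x ≡ there i y → x ≡ y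
  there-injective refl = refl

  there-index : ∀ {i j} {x : Pos (lookup ts i)} {y : Pos (lookup ts j)} → there {ts} i x ≡ there j y → i ≡ j
  there-index refl = refl

  module _ {i : Fin (length ts)} {A : List (Pos (lookup ts i))} where

    used-root : ∀ {c} → UsedChild (node ts) (map (there i) A) here c → c ≡ i
    used-root (_ , ℓ∈ , c≼ℓ) with ∈-map⁻ (there i) ℓ∈
    ... | _ , _ , refl with c≼ℓ
    ...   | there≼ _ = refl

    used-there : ∀ {p c} → UsedChild (node ts) (map (there i) A) (there i p) c → UsedChild (lookup ts i) A p c
    used-there (_ , ℓ∈ , c≼ℓ) with ∈-map⁻ (there i) ℓ∈
    ... | ℓ , ℓ∈A , refl with c≼ℓ
    ...   | there≼ c≼ℓ′ = ℓ , ℓ∈A , c≼ℓ′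

    unused-there : ∀ {a p c} → a ≢ i → ¬ UsedChild (node ts) (map (there i) A) (there a p) c
    unused-there a≢i (_ , ℓ∈ , c≼ℓ) with ∈-map⁻ (there i) ℓ∈
    ... | _ , _ , refl with c≼ℓ
    ...   | there≼ _ = a≢i refl

  lift-binaryLeafSet : ∀ {i A} → BinaryLeafSet (lookup ts i) A → BinaryLeafSet (node ts) (map (there i) A)
  lift-binaryLeafSet {i} {A} (leaves , unique , spans) =
    All.map⁺ leaves , Unique.map⁺ there-injective unique , spans′
    where
    spans′ : SpansBinary (node ts) (map (there i) A)
    spans′ here = noThreeUsed-pair here {j = i} (λ u → inj₁ (used-root u))
    spans′ (there a p) with a ≟ i
    ... | yes refl = noThreeUsed-there p used-there (spans p)
    ... | no a≢i   = noThreeUsed-unused (there a p) (unused-there a≢i)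

  join-binaryLeafSet : ∀ {i j A B} → i ≢ j → BinaryLeafSet (lookup ts i) A → BinaryLeafSet (lookup ts j) B →
    BinaryLeafSet (node ts) (map (there i) A ++ map (there j) B)
  join-binaryLeafSet {i} {j} {A} {B} i≢j (leavesA , uniqueA , spansA) (leavesB , uniqueB , spansB) =
    All.++⁺ (All.map⁺ leavesA) (All.map⁺ leavesB) ,
    Unique.++⁺ (Unique.map⁺ there-injective uniqueA) (Unique.map⁺ there-injective uniqueB) disjoint ,
    spans
    where
    LA = map (there {ts} i) A
    LB = map (there {ts} j) B

    disjoint : ∀ {v} → ¬ (v ∈ LA × v ∈ LB)
    disjoint (v∈A , v∈B) with ∈-map⁻ (there i) v∈A | ∈-map⁻ (there j) v∈B
    ... | _ , _ , refl | _ , _ , e = i≢j (there-index e)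

    spans : SpansBinary (node ts) (LA ++ LB)
    spans here = noThreeUsed-pair here (used-++ LA here (inj₁ ∘ used-root) (inj₂ ∘ used-root))
    spans (there a p) with a ≟ i | a ≟ j
    ... | yes refl | _ =
      noThreeUsed-there p (used-++ LA (there a p) used-there (⊥-elim ∘ unused-there i≢j)) (spansA p)
    ... | no _ | yes refl =
      noThreeUsed-there p (used-++ LA (there a p) (⊥-elim ∘ unused-there (i≢j ∘ sym)) used-there) (spansB p)
    ... | no a≢i | no a≢j =
      noThreeUsed-unused (there a p) (used-++ LA (there a p) (unused-there a≢i) (unused-there a≢j))

leafCountList≡sum : ∀ ts → leafCountList ts ≡ sum (leafCount ∘ lookup ts)
leafCountList≡sum []       = refl
leafCountList≡sum (t ∷ ts) = cong (leafCount t +_) (leafCountList≡sum ts)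

record BinaryLeafSelection (g : ℕ) (t : Tree) : Set where
  field
    leaves  : List (Pos t)
    binary  : BinaryLeafSet t leaves
    bounded : leafCount t ≤ LeafBound.leafBound g (length leaves)

module _ {g : ℕ} where
  open LeafBound g
  open BinaryLeafSelection

  leaf-selection : BinaryLeafSelection g (node [])
  leaf-selection = record { leaves = here ∷ [] ; binary = leaf-binaryLeafSet ; bounded = ≤-refl }

  lift-selection : ∀ {t} → BinaryLeafSelection g t → BinaryLeafSelection g (node (t ∷ []))
  lift-selection S = record
    { leaves  = map (there zero) (leaves S)
    ; binary  = lift-binaryLeafSet (binary S)
    ; bounded = subst₂ _≤_ (sym (+-identityʳ _)) (cong leafBound (sym (length-map _ (leaves S)))) (bounded S)
    }

  join-selection : ∀ {t₁ t₂ rest} → let ts = t₁ ∷ t₂ ∷ rest in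
    length ts ≤ suc g → ((i : Fin (length ts)) → BinaryLeafSelection g (lookup ts i)) →
    BinaryLeafSelection g (node ts)
  join-selection {t₁} {t₂} {rest} deg≤ S = record
    { leaves  = L
    ; binary  = join-binaryLeafSet first≢second (binary (S i₁)) (binary (S i₂))
    ; bounded = begin
        leafCountList ts             ≡⟨ leafCountList≡sum ts ⟩
        sum (leafCount ∘ lookup ts)  ≤⟨ sum-mono-≤ (bounded ∘ S) ⟩
        sum (leafBound ∘ v)          ≤⟨ leafBound-sum-≤ v top (s≤s⁻¹ deg≤) ⟩
        leafBound (v i₁ + v i₂)      ≡⟨ cong leafBound length-L ⟨
        leafBound (length L)         ∎ }
    where
    open ≤-Reasoning
    ts = t₁ ∷ t₂ ∷ rest
    v : Vector ℕ (length ts)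
    v i = length (leaves (S i))
    top = twoLargest v
    open TwoLargest top renaming (first to i₁; second to i₂)
    L : List (Pos (node ts))
    L = map (there i₁) (leaves (S i₁)) ++ map (there i₂) (leaves (S i₂))
    length-L : length L ≡ v i₁ + v i₂
    length-L = trans (length-++ (map (there {ts} i₁) (leaves (S i₁))))
                     (cong₂ _+_ (length-map _ (leaves (S i₁))) (length-map _ (leaves (S i₂))))

  mutual
    select : ∀ t → MaxChildren (suc g) t → BinaryLeafSelection g t
    select (node [])             _         = leaf-selection
    select (node (t ∷ []))       branching = lift-selection (select t (branching ∘ there zero))
    select (node ts@(_ ∷ _ ∷ _)) branching =
      join-selection (branching here) (selectChildren ts (λ i → branching ∘ there i))

    selectChildren : ∀ ts → (∀ i → MaxChildren (suc g) (lookup ts i)) → ∀ i → BinaryLeafSelection g (lookup ts i)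
    selectChildren (t ∷ _)  branching zero    = select t (branching zero)
    selectChildren (_ ∷ ts) branching (suc i) = selectChildren ts (branching ∘ suc) i

lemma3p4 : (h : ℕ) → 2 ≤ h → (T : Tree) → MaxChildren h T →
    Σ (List (Pos T)) (λ L →
      All (IsLeaf T) L × Unique L × SpansBinary T L × RootPowBound h (leafCount T) (length L))
lemma3p4 (suc g) _ T branching with select T branching
... | record { leaves = L ; binary = leaves , unique , spans ; bounded = leafCount≤ } =
  L , leaves , unique , spans , rootPowBound (λ p q → LeafBound.leafBound-root g p q leafCount≤)
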